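{- Let $G$ be a $K_{1,3}$-induced-saturated graph. Then $G$ has at most one isolated vertex, no vertex of degree $1$, at most one vertex of degree $2$, and at most two vertices of degree $3$. Furthermore, if $G$ has an isolated vertex $v$, then $\delta(G - v) \ge 4$. Additionally, if $G$ has a vertex of degree $3$, then $G$ has no vertex of degree $2$; and if $G$ has two vertices of degree $3$ or a vertex of degree $2$, then $G$ has a vertex of degree at least $5$.
   Context: All graphs are finite and simple; $\delta$ denotes minimum degree. For a graph $H$, a graph $G$ is $H$-induced-saturated if $G$ contains no induced subgraph isomorphic to $H$, but for every pair of distinct vertices $u,v$ of $G$, the graph obtained from $G$ by adding the edge $uv$ (if $uv\notin E(G)$) or deleting it (if $uv\in E(G)$) contains an induced subgraph isomorphic to $H$. -}

module Defs where

open import Data.Nat using (ℕ; zero; suc; _+_)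
open import Data.Fin using (Fin; zero; suc; _≟_)
open import Data.Bool using (Bool; true; false; if_then_else_; not; _∧_; _∨_)
open import Data.Product using (_×_; Σ; ∃)
open import Relation.Nullary using (¬_)
open import Relation.Nullary.Decidable using (⌊_⌋)
open import Relation.Binary.PropositionalEquality using (_≡_; _≢_)

record Graph : Set where
  field
    n     : ℕ
    adj   : Fin n → Fin n → Bool
    sym   : ∀ x y → adj x y ≡ adj y x
    irrefl : ∀ x → adj x x ≡ false

open Graph public

count : {m : ℕ} → (Fin m → Bool) → ℕ
count {zero}  p = 0
count {suc m} p = (if p zero then 1 else 0) + count (λ i → p (suc i))

deg : (G : Graph) → Fin (n G) → ℕ
deg G v = count (λ u → adj G v u)

-- degree of u in G - v (vertex v deleted): neighbours of u other than v
degDel : (G : Graph) → (v u : Fin (n G)) → ℕ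
degDel G v u = count (λ w → not ⌊ w ≟ v ⌋ ∧ adj G u w)

HasInducedClaw : {m : ℕ} → (Fin m → Fin m → Bool) → Set
HasInducedClaw {m} A =
  Σ (Fin m) λ c → Σ (Fin m) λ a → Σ (Fin m) λ b → Σ (Fin m) λ d →
    (c ≢ a) × (c ≢ b) × (c ≢ d) × (a ≢ b) × (a ≢ d) × (b ≢ d) ×
    (A c a ≡ true) × (A c b ≡ true) × (A c d ≡ true) ×
    (A a b ≡ false) × (A a d ≡ false) × (A b d ≡ false)

toggle : (G : Graph) → (u v : Fin (n G)) → Fin (n G) → Fin (n G) → Bool
toggle G u v x y =
  if (⌊ x ≟ u ⌋ ∧ ⌊ y ≟ v ⌋) ∨ (⌊ x ≟ v ⌋ ∧ ⌊ y ≟ u ⌋)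
  then not (adj G x y) else adj G x y

ClawIndSat : Graph → Set
ClawIndSat G =
  ¬ HasInducedClaw (adj G) ×
  (∀ (u v : Fin (n G)) → u ≢ v → HasInducedClaw (toggle G u v))

-- Call u simplicial if N(u) is a clique.  By saturation, deleting an edge uw creates a claw with
-- leaves u and w, so u and w have a common neighbour with a neighbour outside N[u]; adding a
-- non-edge uv creates a claw centred at u or at v, so any two simplicial vertices are adjacent.
-- A simplicial neighbour of u has no neighbour outside N[u], while every non-isolated u has two
-- neighbours that do; counting gives the degree bounds, once vertices of degree at most 3 are
-- shown to be simplicial.  Finally, if a simplicial u has only two such neighbours x and y, the
-- claw created by deleting xy is centred at a common neighbour of x and y, and claw-freeness
-- gives it five neighbours.
module Submission where

open import Defs hiding (sym)
open import Function using (_∘_; case_of_)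
open import Data.Nat using (ℕ; zero; suc; _+_; _≤_; _≤?_; z≤n; s≤s)
open import Data.Nat.Properties using (≤-trans; ≤-pred; ≰⇒>; n≮n)
open import Data.Fin using (Fin; zero; suc; _≟_)
open import Data.Bool using (Bool; true; false; not; _∧_; _∨_; if_then_else_)
open import Data.Bool.Properties using (∧-identityʳ; not-¬; ¬-not; not-involutive)
open import Data.Product using (_×_; Σ; _,_; proj₁; proj₂)
open import Data.Sum using (_⊎_; inj₁; inj₂; [_,_])
open import Data.Empty using (⊥-elim)
open import Data.List using (List; []; _∷_; length)
open import Data.List.Relation.Unary.All as All using (All; []; _∷_)
open import Data.List.Relation.Unary.All.Properties using (¬Any⇒All¬)
open import Data.List.Relation.Unary.Any using (Any; here; there; any?)
open import Data.List.Relation.Unary.AllPairs using ([]; _∷_)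
open import Data.List.Relation.Unary.Unique.Propositional using (Unique)
open import Relation.Nullary using (¬_; yes; no; does)
open import Relation.Nullary.Decidable using (Dec; ⌊_⌋; isYes≗does; dec-true; dec-false; _×-dec_; _⊎-dec_)
open import Relation.Binary.PropositionalEquality
  using (_≡_; _≢_; refl; sym; trans; cong; cong₂; subst; ≢-sym)

count-ext : {m : ℕ} {p q : Fin m → Bool} → (∀ i → p i ≡ q i) → count p ≡ count q
count-ext {zero}  p≗q = refl
count-ext {suc m} p≗q rewrite p≗q zero = cong (_ +_) (count-ext (p≗q ∘ suc))

remove : {m : ℕ} → Fin m → (Fin m → Bool) → Fin m → Bool
remove x p i = p i ∧ not ⌊ i ≟ x ⌋

remove-true : {m : ℕ} {p : Fin m → Bool} {x y : Fin m} → p y ≡ true → x ≢ y → remove x p y ≡ true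
remove-true {x = x} {y} py x≢y rewrite py with y ≟ x
... | yes refl = ⊥-elim (x≢y refl)
... | no _     = refl

remove-suc : {m : ℕ} (p : Fin (suc m) → Bool) (x i : Fin m) →
  remove x (p ∘ suc) i ≡ remove (suc x) p (suc i)
remove-suc p x i with i ≟ x
... | yes _ = refl
... | no _  = refl

count-remove : {m : ℕ} (p : Fin m → Bool) (x : Fin m) → p x ≡ true → count p ≡ suc (count (remove x p))
count-remove {suc m} p zero px rewrite px = cong suc (count-ext (λ i → sym (∧-identityʳ (p (suc i)))))
count-remove {suc m} p (suc x) px
  rewrite count-remove (p ∘ suc) x px | count-ext (remove-suc p x) with p zero
... | true  = refl
... | false = refl

length≤count : {m : ℕ} (p : Fin m → Bool) {xs : List (Fin m)} →
  Unique xs → All (λ x → p x ≡ true) xs → length xs ≤ count p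
length≤count p []                 []         = z≤n
length≤count p (x∉xs ∷ xs-unique) (px ∷ pxs) =
  subst (_ ≤_) (sym (count-remove p _ px))
    (s≤s (length≤count (remove _ p) xs-unique
           (All.zipWith (λ (py , x≢y) → remove-true {p = p} py x≢y) (pxs , x∉xs))))

count>0⇒∃true : {m : ℕ} (p : Fin m → Bool) → 1 ≤ count p → Σ (Fin m) λ x → p x ≡ true
count>0⇒∃true {suc m} p 1≤count with p zero in p0
... | true  = zero , p0
... | false with count>0⇒∃true (p ∘ suc) 1≤count
... | x , px = suc x , px

Claw : {m : ℕ} → (Fin m → Fin m → Bool) → Fin m → Fin m → Fin m → Fin m → Set
Claw R c a b d =
  (c ≢ a) × (c ≢ b) × (c ≢ d) × (a ≢ b) × (a ≢ d) × (b ≢ d) ×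
  (R c a ≡ true) × (R c b ≡ true) × (R c d ≡ true) ×
  (R a b ≡ false) × (R a d ≡ false) × (R b d ≡ false)

module _ {m : ℕ} {R : Fin m → Fin m → Bool} (R-sym : ∀ x y → R x y ≡ R y x) {c a b d : Fin m} where

  claw-swap : Claw R c a b d → Claw R c b a d
  claw-swap (c≢a , c≢b , c≢d , a≢b , a≢d , b≢d , ca , cb , cd , ab , ad , bd) =
    c≢b , c≢a , c≢d , ≢-sym a≢b , b≢d , a≢d , cb , ca , cd , trans (R-sym b a) ab , bd , ad

  claw-rotate : Claw R c a b d → Claw R c b d a
  claw-rotate (c≢a , c≢b , c≢d , a≢b , a≢d , b≢d , ca , cb , cd , ab , ad , bd) =
    c≢b , c≢d , c≢a , b≢d , ≢-sym a≢b , ≢-sym a≢d ,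
    cb , cd , ca , bd , trans (R-sym b a) ab , trans (R-sym d a) ad

module GraphBasics (G : Graph) where

  V : Set
  V = Fin (n G)

  infix 4 _~_ _≁_ _∉N[_]

  _~_ : V → V → Set
  x ~ y = adj G x y ≡ true

  _≁_ : V → V → Set
  x ≁ y = adj G x y ≡ false

  ~-sym : {x y : V} → x ~ y → y ~ x
  ~-sym {x} {y} = trans (Graph.sym G y x)

  ≁-sym : {x y : V} → x ≁ y → y ≁ x
  ≁-sym {x} {y} = trans (Graph.sym G y x)

  ~⇒¬≁ : {x y : V} → x ~ y → ¬ (x ≁ y)
  ~⇒¬≁ = not-¬

  ¬~⇒≁ : {x y : V} → ¬ (x ~ y) → x ≁ y
  ¬~⇒≁ = ¬-not

  ¬≁⇒~ : {x y : V} → ¬ (x ≁ y) → x ~ y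
  ¬≁⇒~ = ¬-not

  ~⇒≢ : {x y : V} → x ~ y → x ≢ y
  ~⇒≢ {x} xx refl = ~⇒¬≁ xx (irrefl G x)

  ~-≁-≢ : {x y z : V} → x ~ y → x ≁ z → y ≢ z
  ~-≁-≢ xy xz refl = ~⇒¬≁ xy xz

  _∉N[_] : V → V → Set
  d ∉N[ v ] = (v ≁ d) × (d ≢ v)

  Simplicial : V → Set
  Simplicial u = ∀ x y → u ~ x → u ~ y → x ≢ y → x ~ y

  Escapes : V → V → Set
  Escapes c u = Σ V λ d → (c ~ d) × d ∉N[ u ]

  -- The claws created by deleting the edge uw (centre c, leaves u, w, d) and by adding the
  -- edge uv (centre u, leaves v, p, q).
  DeletedEdgeClaw : V → V → Set
  DeletedEdgeClaw u w = Σ V λ c → (c ~ u) × (c ~ w) × Σ V λ d → (c ~ d) × d ∉N[ u ] × d ∉N[ w ]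

  AddedEdgeClaw : V → V → Set
  AddedEdgeClaw u v =
    Σ V λ p → Σ V λ q → (p ≢ q) × (u ~ p) × (u ~ q) × (p ≁ q) × p ∉N[ v ] × q ∉N[ v ]

  DeletedEdgeClaw-sym : {u w : V} → DeletedEdgeClaw u w → DeletedEdgeClaw w u
  DeletedEdgeClaw-sym (c , cu , cw , d , cd , d∉u , d∉w) = c , cw , cu , d , cd , d∉w , d∉u

  simplicial-no-AddedEdgeClaw : {u v : V} → Simplicial u → ¬ AddedEdgeClaw u v
  simplicial-no-AddedEdgeClaw simp (p , q , p≢q , up , uq , p≁q , _) = ~⇒¬≁ (simp p q up uq p≢q) p≁q

  simplicial-not-escaping : {s u : V} → Simplicial s → s ~ u → ¬ Escapes s u
  simplicial-not-escaping simp su (d , sd , u≁d , d≢u) = ~⇒¬≁ (simp _ d su sd (≢-sym d≢u)) u≁d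

  length≤deg : {u : V} {xs : List V} → Unique xs → All (u ~_) xs → length xs ≤ deg G u
  length≤deg = length≤count _

  isolated-no-neighbour : {u x : V} → deg G u ≡ 0 → ¬ (u ~ x)
  isolated-no-neighbour deg≡0 ux = n≮n 0 (subst (1 ≤_) deg≡0 (length≤deg ([] ∷ []) (ux ∷ [])))

  neighbour-listed : {u c : V} {xs : List V} → Unique xs → All (u ~_) xs → deg G u ≡ length xs →
    u ~ c → Any (c ≡_) xs
  neighbour-listed {c = c} {xs} xs-unique u~xs deg≡ uc with any? (c ≟_) xs
  ... | yes c∈xs = c∈xs
  ... | no c∉xs  = ⊥-elim (n≮n (length xs)
    (subst (_ ≤_) deg≡ (length≤deg (¬Any⇒All¬ xs c∉xs ∷ xs-unique) (uc ∷ u~xs))))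

  degDel≡deg : {u v : V} → ¬ (u ~ v) → degDel G v u ≡ deg G u
  degDel≡deg {u} {v} u≁v = count-ext drop-v
    where
    drop-v : ∀ w → (not ⌊ w ≟ v ⌋ ∧ adj G u w) ≡ adj G u w
    drop-v w with w ≟ v
    ... | yes refl = sym (¬~⇒≁ u≁v)
    ... | no _     = refl

module ClawFree (G : Graph) (claw-free : ¬ HasInducedClaw (adj G)) where
  open GraphBasics G

  claw-free⇒adjacent : {c x y z : V} → c ~ x → c ~ y → c ~ z → x ≢ y → x ≢ z → y ≢ z →
    x ≁ y → x ≁ z → y ~ z
  claw-free⇒adjacent cx cy cz x≢y x≢z y≢z x≁y x≁z = ¬≁⇒~ λ y≁z →
    claw-free (_ , _ , _ , _ , ~⇒≢ cx , ~⇒≢ cy , ~⇒≢ cz , x≢y , x≢z , y≢z ,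
               cx , cy , cz , x≁y , x≁z , y≁z)

  -- d and e are private neighbours of y and x within the triangle u x y; claw-freeness at y
  -- (resp. x) then forces them into N(c).
  5≤deg-of-common-neighbour : {u x y c g d e : V} → u ~ x → u ~ y → x ~ y →
    c ~ x → c ~ y → c ∉N[ u ] → c ~ g → g ∉N[ x ] → g ∉N[ y ] →
    y ~ d → d ∉N[ u ] → d ∉N[ x ] → x ~ e → e ∉N[ u ] → e ∉N[ y ] → 5 ≤ deg G c
  5≤deg-of-common-neighbour {c = c} {d = d} {e} ux uy xy cx cy (u≁c , c≢u) cg (x≁g , g≢x) (y≁g , g≢y)
                            yd (u≁d , d≢u) (x≁d , d≢x) xe (u≁e , e≢u) (y≁e , e≢y) =
    length≤deg
      ((~⇒≢ xy ∷ ≢-sym g≢x ∷ ≢-sym d≢x ∷ ~⇒≢ xe ∷ []) ∷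
       (≢-sym g≢y ∷ ~⇒≢ yd ∷ ≢-sym e≢y ∷ []) ∷
       (≢-sym (~-≁-≢ yd y≁g) ∷ ≢-sym (~-≁-≢ xe x≁g) ∷ []) ∷
       (≢-sym (~-≁-≢ xe x≁d) ∷ []) ∷ [] ∷ [])
      (cx ∷ cy ∷ cg ∷ cd ∷ ce ∷ [])
    where
    cd : c ~ d
    cd = ~-sym (claw-free⇒adjacent (~-sym uy) yd (~-sym cy) (≢-sym d≢u) (≢-sym c≢u)
                  (≢-sym (~-≁-≢ (~-sym cx) x≁d)) u≁d u≁c)
    ce : c ~ e
    ce = ~-sym (claw-free⇒adjacent (~-sym ux) xe (~-sym cx) (≢-sym e≢u) (≢-sym c≢u)
                  (≢-sym (~-≁-≢ (~-sym cy) y≁e)) u≁e u≁c)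

module Toggle (G : Graph) where
  open GraphBasics G

  SamePair : V → V → V → V → Set
  SamePair u v x y = ((x ≡ u) × (y ≡ v)) ⊎ ((x ≡ v) × (y ≡ u))

  same-pair? : (u v x y : V) → Dec (SamePair u v x y)
  same-pair? u v x y = (x ≟ u ×-dec y ≟ v) ⊎-dec (x ≟ v ×-dec y ≟ u)

  same-pair-sym : {u v x y : V} → SamePair u v x y → SamePair u v y x
  same-pair-sym (inj₁ (x≡u , y≡v)) = inj₂ (y≡v , x≡u)
  same-pair-sym (inj₂ (x≡v , y≡u)) = inj₁ (y≡u , x≡v)

  away : {u v x y z w : V} → SamePair u v x y → z ≢ x → z ≢ y → ¬ SamePair u v w z
  away (inj₁ (refl , refl)) z≢x z≢y (inj₁ (_ , z≡v)) = z≢y z≡v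
  away (inj₁ (refl , refl)) z≢x z≢y (inj₂ (_ , z≡u)) = z≢x z≡u
  away (inj₂ (refl , refl)) z≢x z≢y (inj₁ (_ , z≡v)) = z≢x z≡v
  away (inj₂ (refl , refl)) z≢x z≢y (inj₂ (_ , z≡u)) = z≢y z≡u

  away-left : {u v x y z w : V} → SamePair u v x y → z ≢ x → z ≢ y → ¬ SamePair u v z w
  away-left k z≢x z≢y = away k z≢x z≢y ∘ same-pair-sym

  toggle-spec : (u v x y : V) →
    toggle G u v x y ≡ (if does (same-pair? u v x y) then not (adj G x y) else adj G x y)
  toggle-spec u v x y =
    cong (if_then not (adj G x y) else adj G x y)
      (cong₂ _∨_ (cong₂ _∧_ (isYes≗does (x ≟ u)) (isYes≗does (y ≟ v)))
                 (cong₂ _∧_ (isYes≗does (x ≟ v)) (isYes≗does (y ≟ u))))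

  toggle-at : {u v x y : V} → SamePair u v x y → toggle G u v x y ≡ not (adj G x y)
  toggle-at {u} {v} {x} {y} k =
    trans (toggle-spec u v x y) (cong (λ b → if b then _ else _) (dec-true (same-pair? u v x y) k))

  toggle-else : {u v x y : V} → ¬ SamePair u v x y → toggle G u v x y ≡ adj G x y
  toggle-else {u} {v} {x} {y} k =
    trans (toggle-spec u v x y) (cong (λ b → if b then _ else _) (dec-false (same-pair? u v x y) k))

  toggle-sym : {u v : V} (x y : V) → toggle G u v x y ≡ toggle G u v y x
  toggle-sym {u} {v} x y with same-pair? u v x y
  ... | yes k = trans (toggle-at k) (trans (cong not (Graph.sym G x y)) (sym (toggle-at (same-pair-sym k))))
  ... | no k  = trans (toggle-else k) (trans (Graph.sym G x y) (sym (toggle-else (k ∘ same-pair-sym))))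

  kept : {u v x y : V} {β : Bool} → ¬ SamePair u v x y → toggle G u v x y ≡ β → adj G x y ≡ β
  kept k = trans (sym (toggle-else k))

  flipped : {u v x y : V} {β : Bool} → SamePair u v x y → toggle G u v x y ≡ β → adj G x y ≡ not β
  flipped {x = x} {y} k t = trans (sym (not-involutive (adj G x y))) (cong not (trans (sym (toggle-at k)) t))

module Saturated (G : Graph) (claw-free : ¬ HasInducedClaw (adj G))
                 (toggle-has-claw : ∀ u v → u ≢ v → HasInducedClaw (toggle G u v)) where
  open GraphBasics G
  open ClawFree G claw-free
  open Toggle G

  centre-leaf-toggled : {u v c a b d : V} → SamePair u v c a → Claw (toggle G u v) c a b d →
    (c ≁ a) × AddedEdgeClaw c a
  centre-leaf-toggled {u} {v} {b = b} {d} k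
    (c≢a , c≢b , c≢d , a≢b , a≢d , b≢d , cᵗa , cᵗb , cᵗd , aᵗb , aᵗd , bᵗd) =
    flipped k cᵗa , _ , _ , b≢d , kept b-away cᵗb , kept d-away cᵗd , kept d-away bᵗd ,
    (kept b-away aᵗb , ≢-sym a≢b) , (kept d-away aᵗd , ≢-sym a≢d)
    where
    b-away : ∀ {w} → ¬ SamePair u v w b
    b-away = away k (≢-sym c≢b) (≢-sym a≢b)
    d-away : ∀ {w} → ¬ SamePair u v w d
    d-away = away k (≢-sym c≢d) (≢-sym a≢d)

  leaf-leaf-toggled : {u v c a b d : V} → SamePair u v a b → Claw (toggle G u v) c a b d →
    (a ~ b) × DeletedEdgeClaw a b
  leaf-leaf-toggled {u} {v} {c} {d = d} k
    (c≢a , c≢b , c≢d , a≢b , a≢d , b≢d , cᵗa , cᵗb , cᵗd , aᵗb , aᵗd , bᵗd) =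
    flipped k aᵗb , _ , kept c-away cᵗa , kept c-away cᵗb , _ , kept c-away cᵗd ,
    (kept d-away aᵗd , ≢-sym a≢d) , (kept d-away bᵗd , ≢-sym b≢d)
    where
    c-away : ∀ {w} → ¬ SamePair u v c w
    c-away = away-left k c≢a c≢b
    d-away : ∀ {w} → ¬ SamePair u v w d
    d-away = away k (≢-sym a≢d) (≢-sym b≢d)

  swap : {u v c a b d : V} → Claw (toggle G u v) c a b d → Claw (toggle G u v) c b a d
  swap = claw-swap toggle-sym

  rotate : {u v c a b d : V} → Claw (toggle G u v) c a b d → Claw (toggle G u v) c b d a
  rotate = claw-rotate toggle-sym

  ToggleClaw : V → V → Set
  ToggleClaw x y = ((x ≁ y) × AddedEdgeClaw x y) ⊎ ((x ~ y) × DeletedEdgeClaw x y)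

  -- A claw of the toggled graph must contain the toggled pair; its other five pairs are
  -- adjacent exactly as in G.
  toggled-claw : {u v : V} → HasInducedClaw (toggle G u v) →
    Σ V λ x → Σ V λ y → SamePair u v x y × ToggleClaw x y
  toggled-claw {u} {v} (c , a , b , d , claw) with same-pair? u v c a
  ... | yes k = c , a , k , inj₁ (centre-leaf-toggled k claw)
  ... | no k₁ with same-pair? u v c b
  ... | yes k = c , b , k , inj₁ (centre-leaf-toggled k (swap claw))
  ... | no k₂ with same-pair? u v c d
  ... | yes k = c , d , k , inj₁ (centre-leaf-toggled k (rotate (rotate claw)))
  ... | no k₃ with same-pair? u v a b
  ... | yes k = a , b , k , inj₂ (leaf-leaf-toggled k claw)
  ... | no k₄ with same-pair? u v a d
  ... | yes k = a , d , k , inj₂ (leaf-leaf-toggled k (swap (rotate (rotate claw))))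
  ... | no k₅ with same-pair? u v b d
  ... | yes k = b , d , k , inj₂ (leaf-leaf-toggled k (rotate claw))
  ... | no k₆ = ⊥-elim (claw-free (c , a , b , d , untoggled claw))
    where
    untoggled : Claw (toggle G u v) c a b d → Claw (adj G) c a b d
    untoggled (c≢a , c≢b , c≢d , a≢b , a≢d , b≢d , cᵗa , cᵗb , cᵗd , aᵗb , aᵗd , bᵗd) =
      c≢a , c≢b , c≢d , a≢b , a≢d , b≢d ,
      kept k₁ cᵗa , kept k₂ cᵗb , kept k₃ cᵗd , kept k₄ aᵗb , kept k₅ aᵗd , kept k₆ bᵗd

  deleted-edge-claw : {u w : V} → u ~ w → DeletedEdgeClaw u w
  deleted-edge-claw {u} {w} uw with toggled-claw (toggle-has-claw u w (~⇒≢ uw))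
  ... | _ , _ , inj₁ (refl , refl) , inj₁ (u≁w , _) = ⊥-elim (~⇒¬≁ uw u≁w)
  ... | _ , _ , inj₁ (refl , refl) , inj₂ (_ , claw) = claw
  ... | _ , _ , inj₂ (refl , refl) , inj₁ (w≁u , _) = ⊥-elim (~⇒¬≁ uw (≁-sym w≁u))
  ... | _ , _ , inj₂ (refl , refl) , inj₂ (_ , claw) = DeletedEdgeClaw-sym claw

  added-edge-claw : {u v : V} → u ≢ v → u ≁ v → AddedEdgeClaw u v ⊎ AddedEdgeClaw v u
  added-edge-claw {u} {v} u≢v u≁v with toggled-claw (toggle-has-claw u v u≢v)
  ... | _ , _ , inj₁ (refl , refl) , inj₁ (_ , claw) = inj₁ claw
  ... | _ , _ , inj₂ (refl , refl) , inj₁ (_ , claw) = inj₂ claw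
  ... | _ , _ , inj₁ (refl , refl) , inj₂ (u~v , _) = ⊥-elim (~⇒¬≁ u~v u≁v)
  ... | _ , _ , inj₂ (refl , refl) , inj₂ (v~u , _) = ⊥-elim (~⇒¬≁ v~u (≁-sym u≁v))

  simplicial-adjacent : {u v : V} → Simplicial u → Simplicial v → u ≢ v → u ~ v
  simplicial-adjacent su sv u≢v = ¬≁⇒~ λ u≁v →
    [ simplicial-no-AddedEdgeClaw su , simplicial-no-AddedEdgeClaw sv ] (added-edge-claw u≢v u≁v)

  escaping-common-neighbour : {u w : V} → u ~ w → Σ V λ c → (u ~ c) × (c ~ w) × Escapes c u
  escaping-common-neighbour uw with deleted-edge-claw uw
  ... | c , cu , cw , d , cd , d∉u , _ = c , ~-sym cu , cw , d , cd , d∉u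

  two-escaping-neighbours : {u w : V} → u ~ w →
    Σ V λ x → Σ V λ y → (x ≢ y) × (u ~ x) × (u ~ y) × Escapes x u × Escapes y u
  two-escaping-neighbours uw with escaping-common-neighbour uw
  ... | x , ux , _ , x-escapes with escaping-common-neighbour ux
  ... | y , uy , yx , y-escapes = x , y , ≢-sym (~⇒≢ yx) , ux , uy , x-escapes , y-escapes

  2+simplicial-neighbours≤deg : {u w : V} {ss : List V} → u ~ w → Unique ss →
    All (λ s → (u ~ s) × Simplicial s) ss → 2 + length ss ≤ deg G u
  2+simplicial-neighbours≤deg uw ss-unique simplicial-ss with two-escaping-neighbours uw
  ... | x , y , x≢y , ux , uy , x-escapes , y-escapes =
    length≤deg ((x≢y ∷ All.map (escaping≢ x-escapes) simplicial-ss) ∷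
                All.map (escaping≢ y-escapes) simplicial-ss ∷ ss-unique)
               (ux ∷ uy ∷ All.map proj₁ simplicial-ss)
    where
    escaping≢ : ∀ {x s u} → Escapes x u → (u ~ s) × Simplicial s → x ≢ s
    escaping≢ x-escapes (us , simp) refl = simplicial-not-escaping simp (~-sym us) x-escapes

  AddedEdgeClaw-meets-N : {u x z : V} → u ~ x → u ~ z → AddedEdgeClaw x z →
    Σ V λ w → (u ~ w) × (w ≢ x) × (w ≢ z) × (w ≁ z)
  AddedEdgeClaw-meets-N {u} ux uz (p , q , p≢q , xp , xq , p≁q , (z≁p , p≢z) , (z≁q , q≢z))
    with adj G u p in up | adj G u q in uq
  ... | true  | _     = p , up , ≢-sym (~⇒≢ xp) , p≢z , ≁-sym z≁p
  ... | false | true  = q , uq , ≢-sym (~⇒≢ xq) , q≢z , ≁-sym z≁q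
  ... | false | false = ⊥-elim (~⇒¬≁ (claw-free⇒adjacent (~-sym ux) xp xq
                          (~-≁-≢ (~-sym uz) z≁p) (~-≁-≢ (~-sym uz) z≁q) p≢q up uq) p≁q)

  nonadjacent-neighbours : {u x z : V} → u ~ x → u ~ z → x ≢ z → x ≁ z →
    Σ V λ w → (u ~ w) × (w ≢ x) × (w ≢ z) × ((w ≁ x) ⊎ (w ≁ z))
  nonadjacent-neighbours ux uz x≢z x≁z with added-edge-claw x≢z x≁z
  ... | inj₁ claw with AddedEdgeClaw-meets-N ux uz claw
  ... | w , uw , w≢x , w≢z , w≁z = w , uw , w≢x , w≢z , inj₂ w≁z
  nonadjacent-neighbours ux uz x≢z x≁z | inj₂ claw with AddedEdgeClaw-meets-N uz ux claw
  ... | w , uw , w≢z , w≢x , w≁x = w , uw , w≢x , w≢z , inj₁ w≁x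

  third-neighbour-unique : {u x z a b : V} → deg G u ≤ 3 → u ~ x → u ~ z → u ~ a → u ~ b →
    x ≢ z → a ≢ x → a ≢ z → b ≢ x → b ≢ z → a ≡ b
  third-neighbour-unique {a = a} {b} deg≤3 ux uz ua ub x≢z a≢x a≢z b≢x b≢z with a ≟ b
  ... | yes a≡b = a≡b
  ... | no a≢b  = ⊥-elim (n≮n 3 (≤-trans
    (length≤deg ((x≢z ∷ ≢-sym a≢x ∷ ≢-sym b≢x ∷ []) ∷ (≢-sym a≢z ∷ ≢-sym b≢z ∷ []) ∷
                 (a≢b ∷ []) ∷ [] ∷ [])
                (ux ∷ uz ∷ ua ∷ ub ∷ []))
    deg≤3))

  -- For non-adjacent x, z ∈ N(u), both edges ux and uz have a common neighbour in N(u) - {x, z};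
  -- with deg u ≤ 3 these coincide, and adding xz then cannot create a claw.
  deg≤3⇒simplicial : {u : V} → deg G u ≤ 3 → Simplicial u
  deg≤3⇒simplicial deg≤3 x z ux uz x≢z = ¬≁⇒~ absurd
    where
    absurd : ¬ (x ≁ z)
    absurd x≁z with escaping-common-neighbour ux | escaping-common-neighbour uz
                  | nonadjacent-neighbours ux uz x≢z x≁z
    ... | c , uc , cx , _ | c' , uc' , c'z , _ | w , uw , w≢x , w≢z , w≁x⊎w≁z
      with third-neighbour-unique deg≤3 ux uz uc uw x≢z
             (~⇒≢ cx) (~-≁-≢ (~-sym cx) x≁z) w≢x w≢z
         | third-neighbour-unique deg≤3 ux uz uc' uw x≢z
             (~-≁-≢ (~-sym c'z) (≁-sym x≁z)) (~⇒≢ c'z) w≢x w≢z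
    ... | refl | refl = [ ~⇒¬≁ cx , ~⇒¬≁ c'z ] w≁x⊎w≁z

  deg≡⇒simplicial : {u : V} {k : ℕ} → deg G u ≡ k → k ≤ 3 → Simplicial u
  deg≡⇒simplicial deg≡k k≤3 = deg≤3⇒simplicial (subst (_≤ 3) (sym deg≡k) k≤3)

  ∃5≤deg : {u x y : V} → Simplicial u → x ≢ y → u ~ x → u ~ y →
    (∀ c → u ~ c → Escapes c u → (c ≡ x) ⊎ (c ≡ y)) → Σ V λ w → 5 ≤ deg G w
  ∃5≤deg {u} {x} {y} simp x≢y ux uy only-x-y
    with deleted-edge-claw (simp x y ux uy x≢y) | deleted-edge-claw ux | deleted-edge-claw uy
  ... | c , cx , cy , g , cg , g∉x , g∉y | c₁ , c₁u , c₁x , d , c₁d , d∉u , d∉x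
      | c₂ , c₂u , c₂y , e , c₂e , e∉u , e∉y
    with only-x-y c₁ (~-sym c₁u) (d , c₁d , d∉u) | only-x-y c₂ (~-sym c₂u) (e , c₂e , e∉u)
  ... | inj₁ refl | _         = ⊥-elim (~⇒≢ c₁x refl)
  ... | _         | inj₂ refl = ⊥-elim (~⇒≢ c₂y refl)
  ... | inj₂ refl | inj₁ refl =
    c , 5≤deg-of-common-neighbour ux uy (simp x y ux uy x≢y) cx cy (u≁c , c≢u) cg g∉x g∉y
                                  c₁d d∉u d∉x c₂e e∉u e∉y
    where
    g∉u : g ∉N[ u ]
    g∉u = ¬~⇒≁ (λ ug → ~⇒¬≁ (simp x g ux ug (≢-sym (proj₂ g∉x))) (proj₁ g∉x)) ,
          ≢-sym (~-≁-≢ (~-sym ux) (proj₁ g∉x))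
    u≁c : u ≁ c
    u≁c = ¬~⇒≁ λ uc → [ (λ { refl → ~⇒≢ cx refl }) , (λ { refl → ~⇒≢ cy refl }) ]
                         (only-x-y c uc (g , cg , g∉u))
    c≢u : c ≢ u
    c≢u refl = ~⇒¬≁ cg (proj₁ g∉u)

  isolated-unique : ∀ u v → deg G u ≡ 0 → deg G v ≡ 0 → u ≡ v
  isolated-unique u v deg-u deg-v with u ≟ v
  ... | yes u≡v = u≡v
  ... | no u≢v  = ⊥-elim (isolated-no-neighbour deg-u
    (simplicial-adjacent (deg≡⇒simplicial deg-u z≤n) (deg≡⇒simplicial deg-v z≤n) u≢v))

  deg≢1 : ∀ v → deg G v ≢ 1
  deg≢1 v deg-v with count>0⇒∃true (adj G v) (subst (1 ≤_) (sym deg-v) (s≤s z≤n))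
  ... | w , vw = n≮n 1 (subst (2 ≤_) deg-v (2+simplicial-neighbours≤deg vw [] []))

  deg2-unique : ∀ u v → deg G u ≡ 2 → deg G v ≡ 2 → u ≡ v
  deg2-unique u v deg-u deg-v with u ≟ v
  ... | yes u≡v = u≡v
  ... | no u≢v  = ⊥-elim (n≮n 2 (subst (3 ≤_) deg-u
    (2+simplicial-neighbours≤deg uv ([] ∷ []) ((uv , sv) ∷ []))))
    where
    sv : Simplicial v
    sv = deg≡⇒simplicial deg-v (s≤s (s≤s z≤n))
    uv : u ~ v
    uv = simplicial-adjacent (deg≡⇒simplicial deg-u (s≤s (s≤s z≤n))) sv u≢v

  deg3-at-most-two : ∀ a b c → deg G a ≡ 3 → deg G b ≡ 3 → deg G c ≡ 3 →
    (a ≡ b) ⊎ (a ≡ c) ⊎ (b ≡ c)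
  deg3-at-most-two a b c deg-a deg-b deg-c with a ≟ b | a ≟ c | b ≟ c
  ... | yes a≡b | _       | _       = inj₁ a≡b
  ... | no _    | yes a≡c | _       = inj₂ (inj₁ a≡c)
  ... | no _    | no _    | yes b≡c = inj₂ (inj₂ b≡c)
  ... | no a≢b  | no a≢c  | no b≢c  = ⊥-elim (n≮n 3 (subst (4 ≤_) deg-a
    (2+simplicial-neighbours≤deg ab ((b≢c ∷ []) ∷ [] ∷ [])
      ((ab , sb) ∷ (simplicial-adjacent sa sc a≢c , sc) ∷ []))))
    where
    sa : Simplicial a
    sa = deg≡⇒simplicial deg-a (s≤s (s≤s (s≤s z≤n)))
    sb : Simplicial b
    sb = deg≡⇒simplicial deg-b (s≤s (s≤s (s≤s z≤n)))
    sc : Simplicial c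
    sc = deg≡⇒simplicial deg-c (s≤s (s≤s (s≤s z≤n)))
    ab : a ~ b
    ab = simplicial-adjacent sa sb a≢b

  isolated⇒4≤degDel : ∀ v → deg G v ≡ 0 → ∀ u → u ≢ v → 4 ≤ degDel G v u
  isolated⇒4≤degDel v deg-v u u≢v =
    subst (4 ≤_) (sym (degDel≡deg (isolated-no-neighbour deg-v ∘ ~-sym))) 4≤deg-u
    where
    4≤deg-u : 4 ≤ deg G u
    4≤deg-u with 4 ≤? deg G u
    ... | yes 4≤deg = 4≤deg
    ... | no 4≰deg  = ⊥-elim (isolated-no-neighbour deg-v (~-sym
      (simplicial-adjacent (deg≤3⇒simplicial (≤-pred (≰⇒> 4≰deg))) (deg≡⇒simplicial deg-v z≤n) u≢v)))

  deg3⇒deg≢2 : ∀ u v → deg G u ≡ 3 → deg G v ≢ 2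
  deg3⇒deg≢2 u v deg-u deg-v with u ≟ v
  ... | yes refl = case trans (sym deg-u) deg-v of λ ()
  ... | no u≢v   = n≮n 2 (subst (3 ≤_) deg-v
    (2+simplicial-neighbours≤deg vu ([] ∷ []) ((vu , su) ∷ [])))
    where
    su : Simplicial u
    su = deg≡⇒simplicial deg-u (s≤s (s≤s (s≤s z≤n)))
    vu : v ~ u
    vu = ~-sym (simplicial-adjacent su (deg≡⇒simplicial deg-v (s≤s (s≤s z≤n))) u≢v)

  deg2⇒∃5≤deg : ∀ u → deg G u ≡ 2 → Σ V λ w → 5 ≤ deg G w
  deg2⇒∃5≤deg u deg-u with count>0⇒∃true (adj G u) (subst (1 ≤_) (sym deg-u) (s≤s z≤n))
  ... | w , uw with two-escaping-neighbours uw
  ... | x , y , x≢y , ux , uy , _ =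
    ∃5≤deg (deg≡⇒simplicial deg-u (s≤s (s≤s z≤n))) x≢y ux uy only-x-y
    where
    only-x-y : ∀ c → u ~ c → Escapes c u → (c ≡ x) ⊎ (c ≡ y)
    only-x-y c uc _ with neighbour-listed ((x≢y ∷ []) ∷ [] ∷ []) (ux ∷ uy ∷ []) deg-u uc
    ... | here c≡x         = inj₁ c≡x
    ... | there (here c≡y) = inj₂ c≡y

  deg3-beside-simplicial⇒∃5≤deg : {u v : V} → Simplicial u → Simplicial v → u ~ v → deg G u ≡ 3 →
    Σ V λ w → 5 ≤ deg G w
  deg3-beside-simplicial⇒∃5≤deg {u} {v} su sv uv deg-u with two-escaping-neighbours uv
  ... | x , y , x≢y , ux , uy , x-escapes , y-escapes = ∃5≤deg su x≢y ux uy only-x-y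
    where
    v-stays : ¬ Escapes v u
    v-stays = simplicial-not-escaping sv (~-sym uv)
    v≢ : ∀ {z} → Escapes z u → v ≢ z
    v≢ z-escapes refl = v-stays z-escapes
    only-x-y : ∀ c → u ~ c → Escapes c u → (c ≡ x) ⊎ (c ≡ y)
    only-x-y c uc c-escapes
      with neighbour-listed ((v≢ x-escapes ∷ v≢ y-escapes ∷ []) ∷ (x≢y ∷ []) ∷ [] ∷ [])
                            (uv ∷ ux ∷ uy ∷ []) deg-u uc
    ... | here refl                = ⊥-elim (v-stays c-escapes)
    ... | there (here c≡x)         = inj₁ c≡x
    ... | there (there (here c≡y)) = inj₂ c≡y

  two-deg3⇒∃5≤deg : ∀ u v → u ≢ v → deg G u ≡ 3 → deg G v ≡ 3 → Σ V λ w → 5 ≤ deg G w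
  two-deg3⇒∃5≤deg u v u≢v deg-u deg-v =
    deg3-beside-simplicial⇒∃5≤deg su sv (simplicial-adjacent su sv u≢v) deg-u
    where
    su : Simplicial u
    su = deg≡⇒simplicial deg-u (s≤s (s≤s (s≤s z≤n)))
    sv : Simplicial v
    sv = deg≡⇒simplicial deg-v (s≤s (s≤s (s≤s z≤n)))

lemma4p2 : (G : Graph) → ClawIndSat G →
    (∀ u v → deg G u ≡ 0 → deg G v ≡ 0 → u ≡ v) ×
    (∀ v → deg G v ≢ 1) ×
    (∀ u v → deg G u ≡ 2 → deg G v ≡ 2 → u ≡ v) ×
    (∀ a b c → deg G a ≡ 3 → deg G b ≡ 3 → deg G c ≡ 3 →
      (a ≡ b) ⊎ (a ≡ c) ⊎ (b ≡ c)) ×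
    (∀ v → deg G v ≡ 0 → ∀ u → u ≢ v → 4 ≤ degDel G v u) ×
    (∀ u v → deg G u ≡ 3 → deg G v ≢ 2) ×
    (∀ u → ((Σ (Fin (n G)) λ v → (u ≢ v) × (deg G u ≡ 3) × (deg G v ≡ 3))
            ⊎ (deg G u ≡ 2)) →
      Σ (Fin (n G)) λ w → 5 ≤ deg G w)
lemma4p2 G (claw-free , toggle-has-claw) =
  isolated-unique , deg≢1 , deg2-unique , deg3-at-most-two , isolated⇒4≤degDel , deg3⇒deg≢2 ,
  λ u → [ (λ (v , u≢v , deg-u , deg-v) → two-deg3⇒∃5≤deg u v u≢v deg-u deg-v) , deg2⇒∃5≤deg u ]
  where open Saturated G claw-free toggle-has-claw
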